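{- For $n\ge3$, $$\sum_{[\sigma]\in\mathrm{Av}_n([1234],[1342])}q^{\mathrm{cdes}[\sigma]}t^{\mathrm{cpk}[\sigma]}=q^{n-2}t+(2n-6)q^{n-2}t^2+q^{n-1}t.$$
   Context: For a linear permutation $\pi=\pi_1\ldots\pi_n$ of $[n]$, the cyclic permutation $[\pi]$ is the set of all rotations of $\pi$. A linear permutation $\sigma$ contains $\pi$ if some subsequence of $\sigma$ is order isomorphic to $\pi$. A cyclic permutation $[\sigma]$ contains $[\pi]$ if some rotation of $\sigma$ contains $\pi$; otherwise it avoids $[\pi]$. $\mathrm{Av}_n[\Pi]$ is the set of cyclic permutations of length $n$ avoiding every pattern in the set $[\Pi]$. The cyclic descent number is $\mathrm{cdes}[\pi]=\#\{i\in[n]:\pi_i>\pi_{i+1}\}$ and the cyclic peak number is $\mathrm{cpk}[\pi]=\#\{i\in[n]:\pi_{i-1}<\pi_i>\pi_{i+1}\}$, subscripts taken modulo $n$ (both independent of the representative of $[\pi]$). -}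

module Defs where

open import Data.Nat using (ℕ; zero; suc; _+_; _*_; _∸_; _<_; _<?_)
open import Data.Nat.Properties using (_≟_)
open import Data.Bool using (Bool; true; false; if_then_else_; _∧_)
open import Data.List using (List; []; _∷_; _++_; take; drop; length; zipWith; map; sum; applyUpTo; head)
open import Data.List.Relation.Binary.Pointwise using (Pointwise)
open import Data.List.Relation.Binary.Sublist.Propositional using (_⊆_)
open import Data.List.Relation.Binary.Permutation.Propositional using (_↭_)
open import Data.Maybe using (just)
open import Data.Product using (_×_; _,_; ∃; ∃-syntax)
open import Function.Bundles using (_⇔_)
open import Relation.Nullary.Decidable using (does)
open import Relation.Binary.PropositionalEquality using (_≡_)

data OrdIso : List ℕ → List ℕ → Set where
  []  : OrdIso [] []
  _∷_ : ∀ {x y xs ys} →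
        Pointwise (λ x′ y′ → (x < x′ ⇔ y < y′) × (x′ < x ⇔ y′ < y)) xs ys →
        OrdIso xs ys → OrdIso (x ∷ xs) (y ∷ ys)

Contains : List ℕ → List ℕ → Set
Contains π σ = ∃[ τ ] (τ ⊆ σ × OrdIso τ π)

rotate : ℕ → List ℕ → List ℕ
rotate k σ = drop k σ ++ take k σ

CycContains : List ℕ → List ℕ → Set
CycContains π σ = ∃[ k ] (k < length σ × Contains π (rotate k σ))

CycAvoids : List ℕ → List ℕ → Set
CycAvoids π σ = CycContains π σ → Data.Empty.⊥
  where import Data.Empty

IsPerm : ℕ → List ℕ → Set
IsPerm n σ = σ ↭ applyUpTo suc n

-- Each cyclic permutation [σ] of [n] (n ≥ 1) has exactly one representative
-- starting with 1; we use these as representatives of the classes.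
IsCycRep : ℕ → List ℕ → Set
IsCycRep n σ = IsPerm n σ × head σ ≡ just 1

InAv : ℕ → List ℕ → Set
InAv n σ = IsCycRep n σ × CycAvoids (1 ∷ 2 ∷ 3 ∷ 4 ∷ []) σ
                        × CycAvoids (1 ∷ 3 ∷ 4 ∷ 2 ∷ []) σ

count : List Bool → ℕ
count []          = 0
count (true ∷ bs) = suc (count bs)
count (false ∷ bs) = count bs

cdes : List ℕ → ℕ
cdes σ = count (zipWith (λ a b → does (b <? a)) σ (rotate 1 σ))

zipWith3 : (ℕ → ℕ → ℕ → Bool) → List ℕ → List ℕ → List ℕ → List Bool
zipWith3 f (a ∷ as) (b ∷ bs) (c ∷ cs) = f a b c ∷ zipWith3 f as bs cs
zipWith3 f _ _ _ = []

cpk : List ℕ → ℕ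
cpk σ = count (zipWith3 (λ p c nx → does (p <? c) ∧ does (nx <? c))
                        (rotate (length σ ∸ 1) σ) σ (rotate 1 σ))

-- Polynomials in q,t with ℕ coefficients, as lists of monomials
-- (coefficient , exponent of q , exponent of t).
Poly : Set
Poly = List (ℕ × ℕ × ℕ)

coeff : Poly → ℕ → ℕ → ℕ
coeff []                  d p = 0
coeff ((c , e , f) ∷ ms) d p =
  (if does (e ≟ d) ∧ does (f ≟ p) then c else 0) + coeff ms d p

genPoly : List (List ℕ) → Poly
genPoly L = map (λ σ → (1 , cdes σ , cpk σ)) L

rhsPoly : ℕ → Poly
rhsPoly n = (1 , n ∸ 2 , 1) ∷ (2 * n ∸ 6 , n ∸ 2 , 2) ∷ (1 , n ∸ 1 , 1) ∷ []

module Submission where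

-- Write the representative of [σ] that starts with 1 as 1 P 2 Q.  Avoiding [1342] makes P decreasing
-- (else 1 x y 2 occurs) and keeps P and Q from interleaving (else 1 p q y, or cyclically 2 q p x,
-- occurs); avoiding [1234] makes Q decreasing (else 1 2 x y occurs).  Hence P and Q are the two
-- halves, in one order or the other, of the run n, n - 1, …, 3.  Conversely such a word is, read
-- cyclically, the two decreasing runs P 2 and Q 1: a cyclic 1234 would need an ascent inside one run,
-- and a cyclic occurrence a c d b of 1342 must put c into one run and d, b into the other, which the
-- separation of the blocks forbids.  On these words cdes = |P| + max(|Q|, 1) and cpk is the number
-- of nonempty blocks: P = [] gives q^(n-2) t, Q = [] gives q^(n-1) t, and each of the n - 3 splits
-- with both blocks nonempty gives q^(n-2) t^2 twice.

open import Defs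
open import Data.Nat using (ℕ; zero; suc; _+_; _*_; _∸_; _≤_; _<_; _>_; z≤n; s≤s; _<?_; _≟_)
open import Data.Nat.Properties
open import Data.Bool using (Bool; true; false; if_then_else_; _∧_)
open import Data.Bool.Properties using (∧-zeroʳ)
open import Data.List
  using (List; []; _∷_; _++_; [_]; initLast; _∷ʳ′_; length; map; take; drop; applyUpTo; applyDownFrom; zipWith)
open import Data.List.Properties
  using (++-assoc; ++-identityʳ; ∷-injective; take++drop≡id; length-++; length-map; map-++; map-∘;
         length-applyDownFrom; reverse-applyUpTo)
open import Data.List.Relation.Unary.All as All using (All; []; _∷_)
import Data.List.Relation.Unary.All.Properties as All
open import Data.List.Relation.Unary.AllPairs using (AllPairs; []; _∷_)
import Data.List.Relation.Unary.AllPairs.Properties as AllPairs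
open import Data.List.Relation.Unary.Any using (here; there)
open import Data.List.Relation.Unary.Unique.Propositional using (Unique)
import Data.List.Relation.Unary.Unique.Propositional.Properties as Unique
open import Data.List.Relation.Binary.Pointwise using ([]; _∷_)
open import Data.List.Membership.Propositional using (_∈_; _∉_)
open import Data.List.Membership.Propositional.Properties
  using (∈-++⁻; ∈-++⁺ˡ; ∈-++⁺ʳ; ∈-map⁺; ∈-map⁻; ∈-∃++)
open import Data.List.Relation.Binary.Sublist.Propositional
  using (_⊆_; []; _∷_; _∷ʳ_; minimum; to∈; from∈; ⊆-refl; ⊆-trans)
open import Data.List.Relation.Binary.Sublist.Propositional.Properties
  using (All-resp-⊆; ++⁺; ++⁺ʳ; ++⁺ˡ; ∷ˡ⁻)
open import Data.List.Relation.Binary.Permutation.Propositional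
  using (_↭_; ↭-sym; ↭-trans; ↭-reflexive; ↭-prep; ↭⇒↭ₛ)
open import Data.List.Relation.Binary.Permutation.Propositional.Properties
  using (shift; ++-comm; drop-∷; ∈-resp-↭; ↭-reverse; All-resp-↭)
import Data.List.Relation.Binary.Permutation.Setoid.Properties as Permutationₛ
import Data.Product as Product
open import Data.Product using (Σ-syntax; ∃; ∃₂; _×_; _,_; proj₁; proj₂)
open import Data.Sum using (_⊎_; inj₁; inj₂)
open import Data.Empty using (⊥; ⊥-elim)
open import Function.Base using (_∘_)
open import Function.Bundles using (_⇔_; mk⇔; Equivalence)
open import Relation.Nullary using (¬_)
open import Relation.Nullary.Decidable using (does; dec-true; dec-false; True; toWitness)
open import Relation.Binary.Definitions using (tri<; tri≈; tri>)
open import Relation.Binary.PropositionalEquality hiding ([_])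

Decreasing : List ℕ → Set
Decreasing = AllPairs _>_

Above : List ℕ → List ℕ → Set
Above xs ys = All (λ x → All (_< x) ys) xs

Separated : List ℕ → List ℕ → Set
Separated P Q = Above P Q ⊎ Above Q P

Halves : List ℕ → List ℕ → List ℕ → Set
Halves D P Q = P ++ Q ≡ D ⊎ Q ++ P ≡ D

run : ℕ → ℕ → List ℕ
run s = applyDownFrom (s +_)

AllPairs-resp-⊇ : ∀ {A : Set} {R : A → A → Set} {xs ys} → xs ⊆ ys → AllPairs R ys → AllPairs R xs
AllPairs-resp-⊇ []         []         = []
AllPairs-resp-⊇ (_ ∷ʳ τ)   (_ ∷ rys)  = AllPairs-resp-⊇ τ rys
AllPairs-resp-⊇ (refl ∷ τ) (ry ∷ rys) = All-resp-⊆ τ ry ∷ AllPairs-resp-⊇ τ rys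

AllPairs-pair : ∀ {A : Set} {R : A → A → Set} {x y xs} → AllPairs R xs → (x ∷ y ∷ []) ⊆ xs → R x y
AllPairs-pair rxs τ with (rxy ∷ []) ∷ _ ← AllPairs-resp-⊇ τ rxs = rxy

AllPairs-from-pairs : ∀ {A : Set} {R : A → A → Set} xs →
  (∀ {x y} → (x ∷ y ∷ []) ⊆ xs → R x y) → AllPairs R xs
AllPairs-from-pairs []       r = []
AllPairs-from-pairs (x ∷ xs) r =
  All.tabulate (λ y∈xs → r (refl ∷ from∈ y∈xs)) ∷ AllPairs-from-pairs xs (λ τ → r (x ∷ʳ τ))

AllPairs-++⁻ : ∀ {A : Set} {R : A → A → Set} xs {ys} → AllPairs R (xs ++ ys) →
  AllPairs R xs × AllPairs R ys × All (λ x → All (R x) ys) xs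
AllPairs-++⁻ []       rys        = [] , rys , []
AllPairs-++⁻ (x ∷ xs) (rx ∷ rxs) with rxs′ , rys , rxys ← AllPairs-++⁻ xs rxs =
  All.++⁻ˡ xs rx ∷ rxs′ , rys , All.++⁻ʳ xs rx ∷ rxys

⊆-++⁻ : ∀ {A : Set} {xs} ys {zs : List A} → xs ⊆ ys ++ zs →
  ∃₂ λ xs₁ xs₂ → xs ≡ xs₁ ++ xs₂ × xs₁ ⊆ ys × xs₂ ⊆ zs
⊆-++⁻ []       τ = [] , _ , refl , [] , τ
⊆-++⁻ (y ∷ ys) (.y ∷ʳ τ) with xs₁ , xs₂ , refl , τ₁ , τ₂ ← ⊆-++⁻ ys τ =
  xs₁ , xs₂ , refl , y ∷ʳ τ₁ , τ₂
⊆-++⁻ (y ∷ ys) (refl ∷ τ) with xs₁ , xs₂ , refl , τ₁ , τ₂ ← ⊆-++⁻ ys τ =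
  y ∷ xs₁ , xs₂ , refl , refl ∷ τ₁ , τ₂

⊆-∷ʳ⁻ : ∀ {A : Set} {xs ys : List A} {u z} → xs ++ [ u ] ⊆ ys ++ [ z ] → xs ⊆ ys
⊆-∷ʳ⁻ {xs = []}                     _          = minimum _
⊆-∷ʳ⁻ {xs = _ ∷ _}     {[]}          (_ ∷ʳ ())
⊆-∷ʳ⁻ {xs = _ ∷ []}    {[]}          (refl ∷ ())
⊆-∷ʳ⁻ {xs = _ ∷ _ ∷ _} {[]}          (refl ∷ ())
⊆-∷ʳ⁻ {xs = x ∷ xs}    {y ∷ ys}      (.y ∷ʳ τ)  = y ∷ʳ ⊆-∷ʳ⁻ {xs = x ∷ xs} τ
⊆-∷ʳ⁻ {xs = _ ∷ _}     {_ ∷ _}       (refl ∷ τ) = refl ∷ ⊆-∷ʳ⁻ τ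

++-cancel-length : ∀ {A : Set} {xs xs′ ys ys′ : List A} →
  length xs ≡ length xs′ → xs ++ ys ≡ xs′ ++ ys′ → xs ≡ xs′ × ys ≡ ys′
++-cancel-length {xs = []}     {[]}       _   eq = refl , eq
++-cancel-length {xs = x ∷ xs} {_ ∷ xs′}  len eq with refl , eq′ ← ∷-injective eq =
  Product.map₁ (cong (x ∷_)) (++-cancel-length (suc-injective len) eq′)

split-at : ∀ {A : Set} {z : A} P {Q P′ Q′} → z ∉ P → z ∉ P′ →
  P ++ z ∷ Q ≡ P′ ++ z ∷ Q′ → (P , Q) ≡ (P′ , Q′)
split-at []      {P′ = []}     _   _    eq = cong ([] ,_) (proj₂ (∷-injective eq))
split-at []      {P′ = _ ∷ _}  _   z∉P′ eq = ⊥-elim (z∉P′ (here (proj₁ (∷-injective eq))))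
split-at (_ ∷ _) {P′ = []}     z∉P _    eq = ⊥-elim (z∉P (here (sym (proj₁ (∷-injective eq)))))
split-at (p ∷ P) {P′ = _ ∷ P′} z∉P z∉P′ eq with refl , eq′ ← ∷-injective eq =
  cong (Product.map₁ (p ∷_)) (split-at P (z∉P ∘ there) (z∉P′ ∘ there) eq′)

length-<-++ : ∀ {A : Set} (xs : List A) {y ys} → length xs < length (xs ++ y ∷ ys)
length-<-++ []       = s≤s z≤n
length-<-++ (_ ∷ xs) = s≤s (length-<-++ xs)

drop-length-++ : ∀ (xs ys : List ℕ) → drop (length xs) (xs ++ ys) ≡ ys
drop-length-++ []       ys = refl
drop-length-++ (_ ∷ xs) ys = drop-length-++ xs ys

take-length-++ : ∀ (xs ys : List ℕ) → take (length xs) (xs ++ ys) ≡ xs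
take-length-++ []       ys = refl
take-length-++ (x ∷ xs) ys = cong (x ∷_) (take-length-++ xs ys)

rotate-length-++ : ∀ (xs ys : List ℕ) → rotate (length xs) (xs ++ ys) ≡ ys ++ xs
rotate-length-++ xs ys = cong₂ _++_ (drop-length-++ xs ys) (take-length-++ xs ys)

head-max : ∀ {x y xs} → Decreasing (x ∷ xs) → y ∈ x ∷ xs → y ≤ x
head-max _          (here refl)  = ≤-refl
head-max (x>xs ∷ _) (there y∈xs) = <⇒≤ (All.lookup x>xs y∈xs)

above-head : ∀ {p P Q} → Decreasing (p ∷ P) → All (p <_) Q → Above Q (p ∷ P)
above-head P↓ p<Q = All.map (λ p<y → All.tabulate (λ x∈P → ≤-<-trans (head-max P↓ x∈P) p<y)) p<Q

decreasing-↭⇒≡ : ∀ {xs ys} → Decreasing xs → Decreasing ys → xs ↭ ys → xs ≡ ys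
decreasing-↭⇒≡ []           []           _ = refl
decreasing-↭⇒≡ []           (_ ∷ _)      p with () ← ∈-resp-↭ (↭-sym p) (here refl)
decreasing-↭⇒≡ (_ ∷ _)      []           p with () ← ∈-resp-↭ p (here refl)
decreasing-↭⇒≡ (x>xs ∷ xs↓) (y>ys ∷ ys↓) p
  with refl ← ≤-antisym (head-max (y>ys ∷ ys↓) (∈-resp-↭ p (here refl)))
                        (head-max (x>xs ∷ xs↓) (∈-resp-↭ (↭-sym p) (here refl)))
  = cong (_ ∷_) (decreasing-↭⇒≡ xs↓ ys↓ (drop-∷ p))

separated-sym : ∀ {P Q} → Separated P Q → Separated Q P
separated-sym (inj₁ P>Q) = inj₂ P>Q
separated-sym (inj₂ Q>P) = inj₁ Q>P

separated⇒¬between : ∀ {P Q b c d} → Separated P Q → b ∈ P → d ∈ P → c ∈ Q → b < c → ¬ c < d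
separated⇒¬between (inj₁ P>Q) b∈P _   c∈Q b<c _   = <-asym b<c (All.lookup (All.lookup P>Q b∈P) c∈Q)
separated⇒¬between (inj₂ Q>P) _   d∈P c∈Q _   c<d = <-asym c<d (All.lookup (All.lookup Q>P c∈Q) d∈P)

separated⇒halves : ∀ {D P Q} → Decreasing D → Decreasing P → Decreasing Q → Separated P Q →
  P ++ Q ↭ D → Halves D P Q
separated⇒halves D↓ P↓ Q↓ (inj₁ P>Q) P++Q↭D =
  inj₁ (decreasing-↭⇒≡ (AllPairs.++⁺ P↓ Q↓ P>Q) D↓ P++Q↭D)
separated⇒halves {P = P} {Q} D↓ P↓ Q↓ (inj₂ Q>P) P++Q↭D =
  inj₂ (decreasing-↭⇒≡ (AllPairs.++⁺ Q↓ P↓ Q>P) D↓ (↭-trans (++-comm Q P) P++Q↭D))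

halves-↭ : ∀ {D} P Q → Halves D P Q → P ++ Q ↭ D
halves-↭ P Q (inj₁ P++Q≡D) = ↭-reflexive P++Q≡D
halves-↭ P Q (inj₂ Q++P≡D) = ↭-trans (++-comm P Q) (↭-reflexive Q++P≡D)

run-decreasing : ∀ s k → Decreasing (run s k)
run-decreasing s k = AllPairs.applyDownFrom⁺₁ (s +_) k (λ j<i _ → +-monoʳ-< s j<i)

run-≥ : ∀ s k → All (s ≤_) (run s k)
run-≥ s k = All.applyDownFrom⁺₂ (s +_) k (m≤m+n s)

run-↭ : ∀ s k → run s k ↭ applyUpTo (s +_) k
run-↭ s k = ↭-trans (↭-reflexive (sym (reverse-applyUpTo (s +_) k))) (↭-reverse (applyUpTo (s +_) k))

run-++ : ∀ s p q → run s (p + q) ≡ run (s + q) p ++ run s q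
run-++ s zero    q = refl
run-++ s (suc p) q = cong₂ _∷_ (trans (cong (s +_) (+-comm p q)) (sym (+-assoc s q p))) (run-++ s p q)

length-run : ∀ s k → length (run s k) ≡ k
length-run s = length-applyDownFrom (s +_)

run-injectiveʳ : ∀ {s s′ k k′} → run s k ≡ run s′ k′ → k ≡ k′
run-injectiveʳ {s} {s′} {k} {k′} eq = trans (sym (length-run s k)) (trans (cong length eq) (length-run s′ k′))

split-run : ∀ {s m} U V → U ++ V ≡ run s m →
  (U ≡ run (s + length V) (length U) × V ≡ run s (length V)) × length U + length V ≡ m
split-run {s} {m} U V eq =
  ++-cancel-length (sym (length-run _ (length U)))
                   (trans eq (trans (cong (run s) (sym lengths)) (run-++ s (length U) (length V)))) ,
  lengths
  where
  lengths : length U + length V ≡ m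
  lengths = trans (sym (length-++ U)) (trans (cong length eq) (length-run s m))

-- Cyclic occurrences

CycSublist : List ℕ → List ℕ → Set
CycSublist w σ = ∃₂ λ u v → w ≡ u ++ v × v ++ u ⊆ σ

CycSublist₄ : ℕ → ℕ → ℕ → ℕ → List ℕ → Set
CycSublist₄ a b c d σ =
  (a ∷ b ∷ c ∷ d ∷ []) ⊆ σ ⊎ (b ∷ c ∷ d ∷ a ∷ []) ⊆ σ ⊎
  (c ∷ d ∷ a ∷ b ∷ []) ⊆ σ ⊎ (d ∷ a ∷ b ∷ c ∷ []) ⊆ σ

⊆-rotate⇒CycSublist : ∀ k σ {w} → w ⊆ rotate k σ → CycSublist w σ
⊆-rotate⇒CycSublist k σ τ with w₁ , w₂ , refl , τ₁ , τ₂ ← ⊆-++⁻ (drop k σ) τ =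
  w₁ , w₂ , refl , subst (_ ⊆_) (take++drop≡id k σ) (++⁺ τ₂ τ₁)

CycSublist-rotate : ∀ {w x} σ → CycSublist w (x ∷ σ) → CycSublist w (σ ++ [ x ])
CycSublist-rotate σ (u     , []    , eq   , _ ∷ʳ τ)   = u , [] , eq , ++⁺ʳ _ τ
CycSublist-rotate σ (x ∷ u , []    , refl , refl ∷ τ) =
  [ x ] , u , cong (x ∷_) (++-identityʳ u) , ++⁺ τ (refl ∷ [])
CycSublist-rotate σ (u     , x ∷ v , eq   , _ ∷ʳ τ)   = u , x ∷ v , eq , ++⁺ʳ _ τ
CycSublist-rotate σ (u     , x ∷ v , refl , refl ∷ τ) =
  u ++ [ x ] , v , sym (++-assoc u [ x ] v) , subst (_⊆ σ ++ [ x ]) (++-assoc v u [ x ]) (++⁺ τ (refl ∷ []))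

CycSublist⇒CycSublist₄ : ∀ {a b c d σ} → CycSublist (a ∷ b ∷ c ∷ d ∷ []) σ → CycSublist₄ a b c d σ
CycSublist⇒CycSublist₄ ([]                    , _     , refl , τ) = inj₁ τ
CycSublist⇒CycSublist₄ (_ ∷ []                , _     , refl , τ) = inj₂ (inj₁ τ)
CycSublist⇒CycSublist₄ (_ ∷ _ ∷ []            , _     , refl , τ) = inj₂ (inj₂ (inj₁ τ))
CycSublist⇒CycSublist₄ (_ ∷ _ ∷ _ ∷ []        , _     , refl , τ) = inj₂ (inj₂ (inj₂ τ))
CycSublist⇒CycSublist₄ (_ ∷ _ ∷ _ ∷ _ ∷ []    , []    , refl , τ) = inj₁ τ
CycSublist⇒CycSublist₄ (_ ∷ _ ∷ _ ∷ _ ∷ []    , _ ∷ _ , ()   , _)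
CycSublist⇒CycSublist₄ (_ ∷ _ ∷ _ ∷ _ ∷ _ ∷ _ , _     , ()   , _)

<-numeral : ∀ {m n} {m<n : True (m <? n)} → m < n
<-numeral {m<n = m<n} = toWitness m<n

open Equivalence using (from)

cycAvoids-1234⁺ : ∀ {σ} → (∀ {a b c d} → a < b → b < c → c < d → ¬ CycSublist (a ∷ b ∷ c ∷ d ∷ []) σ) →
  CycAvoids (1 ∷ 2 ∷ 3 ∷ 4 ∷ []) σ
cycAvoids-1234⁺ {σ} noOcc (k , _ , _ , τ , (ab ∷ _ ∷ _ ∷ []) ∷ (bc ∷ _ ∷ []) ∷ (cd ∷ []) ∷ [] ∷ []) =
  noOcc (from (proj₁ ab) <-numeral) (from (proj₁ bc) <-numeral) (from (proj₁ cd) <-numeral)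
        (⊆-rotate⇒CycSublist k σ τ)

-- an occurrence of 1342 is written a c d b with a < b < c < d
cycAvoids-1342⁺ : ∀ {σ} → (∀ {a b c d} → a < b → b < c → c < d → ¬ CycSublist (a ∷ c ∷ d ∷ b ∷ []) σ) →
  CycAvoids (1 ∷ 3 ∷ 4 ∷ 2 ∷ []) σ
cycAvoids-1342⁺ {σ} noOcc (k , _ , _ , τ , (_ ∷ _ ∷ ab ∷ []) ∷ (cd ∷ bc ∷ []) ∷ _ ∷ [] ∷ []) =
  noOcc (from (proj₁ ab) <-numeral) (from (proj₂ bc) <-numeral) (from (proj₁ cd) <-numeral)
        (⊆-rotate⇒CycSublist k σ τ)

pair-iso-< : ∀ {x x′ y y′} → x < x′ → y < y′ → (x < x′ ⇔ y < y′) × (x′ < x ⇔ y′ < y)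
pair-iso-< p q = mk⇔ (λ _ → q) (λ _ → p) , mk⇔ (λ r → ⊥-elim (<-asym p r)) (λ r → ⊥-elim (<-asym q r))

pair-iso-> : ∀ {x x′ y y′} → x′ < x → y′ < y → (x < x′ ⇔ y < y′) × (x′ < x ⇔ y′ < y)
pair-iso-> p q = mk⇔ (λ r → ⊥-elim (<-asym p r)) (λ r → ⊥-elim (<-asym q r)) , mk⇔ (λ _ → q) (λ _ → p)

ordIso-1234 : ∀ {a b c d} → a < b → b < c → c < d →
  OrdIso (a ∷ b ∷ c ∷ d ∷ []) (1 ∷ 2 ∷ 3 ∷ 4 ∷ [])
ordIso-1234 a<b b<c c<d =
  (pair-iso-< a<b <-numeral ∷ pair-iso-< a<c <-numeral ∷ pair-iso-< (<-trans a<c c<d) <-numeral ∷ [])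
  ∷ (pair-iso-< b<c <-numeral ∷ pair-iso-< (<-trans b<c c<d) <-numeral ∷ [])
  ∷ (pair-iso-< c<d <-numeral ∷ []) ∷ [] ∷ []
  where
  a<c = <-trans a<b b<c

ordIso-1342 : ∀ {a b c d} → a < b → b < c → c < d →
  OrdIso (a ∷ c ∷ d ∷ b ∷ []) (1 ∷ 3 ∷ 4 ∷ 2 ∷ [])
ordIso-1342 a<b b<c c<d =
  (pair-iso-< a<c <-numeral ∷ pair-iso-< (<-trans a<c c<d) <-numeral ∷ pair-iso-< a<b <-numeral ∷ [])
  ∷ (pair-iso-< c<d <-numeral ∷ pair-iso-> b<c <-numeral ∷ [])
  ∷ (pair-iso-> (<-trans b<c c<d) <-numeral ∷ []) ∷ [] ∷ []
  where
  a<c = <-trans a<b b<c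

cycContains-at-start : ∀ {π w x σ} → (x ∷ w) ⊆ σ → OrdIso (x ∷ w) π → CycContains π σ
cycContains-at-start {σ = σ} τ iso = 0 , nonempty τ , _ , subst (_ ⊆_) (sym (++-identityʳ σ)) τ , iso
  where
  nonempty : ∀ {x w σ} → (x ∷ w) ⊆ σ → 0 < length σ
  nonempty (_ ∷ʳ _) = s≤s z≤n
  nonempty (_ ∷ _)  = s≤s z≤n

-- Avoidance by two cyclic runs

no-ascent : ∀ {S u v ws} → Decreasing S → (u ∷ v ∷ ws) ⊆ S → ¬ u < v
no-ascent S↓ τ u<v = <-asym u<v (AllPairs-pair S↓ (⊆-trans (refl ∷ refl ∷ minimum _) τ))

⊆-++-skip : ∀ {R S v ws} → All (_< v) R → (v ∷ ws) ⊆ R ++ S → (v ∷ ws) ⊆ S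
⊆-++-skip []        τ          = τ
⊆-++-skip (_ ∷ R<v) (_ ∷ʳ τ)   = ⊆-++-skip R<v τ
⊆-++-skip (v<v ∷ _) (refl ∷ τ) = ⊥-elim (<-irrefl refl v<v)

ascent-splits : ∀ {R S u v ws} zs → Decreasing R → Decreasing S →
  (zs ++ u ∷ v ∷ ws) ⊆ R ++ S → u < v → (zs ++ [ u ]) ⊆ R × (v ∷ ws) ⊆ S
ascent-splits zs       []        S↓ τ          u<v = ⊥-elim (no-ascent S↓ (⊆-trans (++⁺ˡ zs ⊆-refl) τ) u<v)
ascent-splits []       (u>R ∷ _) S↓ (refl ∷ τ) u<v =
  refl ∷ minimum _ , ⊆-++-skip (All.map (λ r<u → <-trans r<u u<v) u>R) τ
ascent-splits (_ ∷ zs) (_ ∷ R↓)  S↓ (refl ∷ τ) u<v =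
  Product.map₁ (refl ∷_) (ascent-splits zs R↓ S↓ τ u<v)
ascent-splits []       (_ ∷ R↓)  S↓ (r ∷ʳ τ)   u<v =
  Product.map₁ (r ∷ʳ_) (ascent-splits [] R↓ S↓ τ u<v)
ascent-splits (z ∷ zs) (_ ∷ R↓)  S↓ (r ∷ʳ τ)   u<v =
  Product.map₁ (r ∷ʳ_) (ascent-splits (z ∷ zs) R↓ S↓ τ u<v)

-- Read cyclically, x ∷ P ++ y ∷ Q is the two decreasing runs P y and Q x, each entered by an ascent.
record TwoRuns (x y : ℕ) (P Q : List ℕ) : Set where
  field
    run₁ : Decreasing (P ++ [ y ])
    run₂ : Decreasing (Q ++ [ x ])
    x<P  : All (x <_) P
    y<Q  : All (y <_) Q

module _ {x y P Q} (runs : TwoRuns x y P Q) where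

  open TwoRuns runs

  private
    rotated : ∀ {w} → CycSublist w (x ∷ P ++ y ∷ Q) → CycSublist w ((P ++ [ y ]) ++ (Q ++ [ x ]))
    rotated occ = subst (CycSublist _) (trans (++-assoc P (y ∷ Q) [ x ]) (sym (++-assoc P [ y ] (Q ++ [ x ]))))
                        (CycSublist-rotate (P ++ y ∷ Q) occ)

    splits : ∀ {u v ws} zs → (zs ++ u ∷ v ∷ ws) ⊆ (P ++ [ y ]) ++ (Q ++ [ x ]) → u < v →
      (zs ++ [ u ]) ⊆ P ++ [ y ] × (v ∷ ws) ⊆ Q ++ [ x ]
    splits zs = ascent-splits zs run₁ run₂

  twoRuns⇒cycAvoids-1234 : CycAvoids (1 ∷ 2 ∷ 3 ∷ 4 ∷ []) (x ∷ P ++ y ∷ Q)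
  twoRuns⇒cycAvoids-1234 =
    cycAvoids-1234⁺ λ a<b b<c c<d occ → no-rotation a<b b<c c<d (CycSublist⇒CycSublist₄ (rotated occ))
    where
    no-rotation : ∀ {a b c d} → a < b → b < c → c < d → ¬ CycSublist₄ a b c d ((P ++ [ y ]) ++ (Q ++ [ x ]))
    no-rotation a<b b<c c<d (inj₁ τ)               = no-ascent run₂ (proj₂ (splits [] τ a<b)) b<c
    no-rotation a<b b<c c<d (inj₂ (inj₁ τ))        = no-ascent run₂ (proj₂ (splits [] τ b<c)) c<d
    no-rotation a<b b<c c<d (inj₂ (inj₂ (inj₁ τ))) = no-ascent run₂ (∷ˡ⁻ (proj₂ (splits [] τ c<d))) a<b
    no-rotation a<b b<c c<d (inj₂ (inj₂ (inj₂ τ))) = no-ascent run₂ (proj₂ (splits [ _ ] τ a<b)) b<c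

  twoRuns⇒cycAvoids-1342 : Separated P Q → CycAvoids (1 ∷ 3 ∷ 4 ∷ 2 ∷ []) (x ∷ P ++ y ∷ Q)
  twoRuns⇒cycAvoids-1342 sep =
    cycAvoids-1342⁺ λ a<b b<c c<d occ → no-rotation a<b b<c c<d (CycSublist⇒CycSublist₄ (rotated occ))
    where
    no-rotation : ∀ {a b c d} → a < b → b < c → c < d → ¬ CycSublist₄ a c d b ((P ++ [ y ]) ++ (Q ++ [ x ]))
    no-rotation a<b b<c c<d (inj₁ τ) = no-ascent run₂ (proj₂ (splits [] τ (<-trans a<b b<c))) c<d
    no-rotation a<b b<c c<d (inj₂ (inj₁ τ))
      with τ₁ , τ₂ ← splits [] τ c<d
      with db⊆Q ← ⊆-∷ʳ⁻ {xs = _ ∷ _ ∷ []} τ₂ | ∈-++⁻ P (to∈ τ₁)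
    ... | inj₁ c∈P         =
      separated⇒¬between (separated-sym sep) (to∈ (∷ˡ⁻ db⊆Q)) (to∈ db⊆Q) c∈P b<c c<d
    ... | inj₂ (here refl) = <-asym b<c (All.lookup y<Q (to∈ (∷ˡ⁻ db⊆Q)))
    no-rotation a<b b<c c<d (inj₂ (inj₂ (inj₁ τ)))
      with τ₁ , τ₂ ← splits (_ ∷ _ ∷ []) τ (<-trans a<b b<c)
      with db⊆P ← ⊆-∷ʳ⁻ {xs = _ ∷ _ ∷ []} τ₁ | ∈-++⁻ Q (to∈ τ₂)
    ... | inj₁ c∈Q         = separated⇒¬between sep (to∈ (∷ˡ⁻ db⊆P)) (to∈ db⊆P) c∈Q b<c c<d
    ... | inj₂ (here refl) = <-asym b<c (All.lookup x<P (to∈ (∷ˡ⁻ db⊆P)))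
    no-rotation a<b b<c c<d (inj₂ (inj₂ (inj₂ τ))) =
      no-ascent run₂ (proj₂ (splits [ _ ] τ (<-trans a<b b<c))) c<d

twoRuns-below : ∀ {x y P Q} → x < y → Decreasing P → Decreasing Q → All (y <_) P → All (y <_) Q →
  TwoRuns x y P Q
twoRuns-below x<y P↓ Q↓ y<P y<Q = record
  { run₁ = AllPairs.++⁺ P↓ ([] ∷ []) (All.map (_∷ []) y<P)
  ; run₂ = AllPairs.++⁺ Q↓ ([] ∷ []) (All.map (λ y<q → <-trans x<y y<q ∷ []) y<Q)
  ; x<P  = All.map (<-trans x<y) y<P
  ; y<Q  = y<Q
  }

halves⇒twoRuns : ∀ {x y D P Q} → x < y → Decreasing D → All (y <_) D → Halves D P Q →
  TwoRuns x y P Q × Separated P Q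
halves⇒twoRuns {P = P} x<y D↓ y<D (inj₁ refl)
  with P↓ , Q↓ , P>Q ← AllPairs-++⁻ P D↓ | y<P , y<Q ← All.++⁻ P y<D =
  twoRuns-below x<y P↓ Q↓ y<P y<Q , inj₁ P>Q
halves⇒twoRuns {Q = Q} x<y D↓ y<D (inj₂ refl)
  with Q↓ , P↓ , Q>P ← AllPairs-++⁻ Q D↓ | y<Q , y<P ← All.++⁻ Q y<D =
  twoRuns-below x<y P↓ Q↓ y<P y<Q , inj₂ Q>P

-- The structure of avoiders

≢∧≮⇒> : ∀ {x y} → x ≢ y → ¬ x < y → y < x
≢∧≮⇒> x≢y x≮y = ≤∧≢⇒< (≮⇒≥ x≮y) (≢-sym x≢y)

cycAvoids-1342⇒P-decreasing : ∀ {P Q} → All (2 <_) (P ++ Q) → Unique (P ++ Q) →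
  CycAvoids (1 ∷ 3 ∷ 4 ∷ 2 ∷ []) (1 ∷ P ++ 2 ∷ Q) → Decreasing P
cycAvoids-1342⇒P-decreasing {P} {Q} large distinct avoid = AllPairs-from-pairs P λ τ →
  ≢∧≮⇒> (AllPairs-pair distinct (++⁺ τ (minimum Q))) λ x<y →
    avoid (cycContains-at-start (refl ∷ ++⁺ τ (refl ∷ minimum Q))
                                (ordIso-1342 <-numeral (All.lookup large (∈-++⁺ˡ (to∈ τ))) x<y))

cycAvoids-1234⇒Q-decreasing : ∀ {P Q} → All (2 <_) (P ++ Q) → Unique (P ++ Q) →
  CycAvoids (1 ∷ 2 ∷ 3 ∷ 4 ∷ []) (1 ∷ P ++ 2 ∷ Q) → Decreasing Q
cycAvoids-1234⇒Q-decreasing {P} {Q} large distinct avoid = AllPairs-from-pairs Q λ τ →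
  ≢∧≮⇒> (AllPairs-pair distinct (++⁺ˡ P τ)) λ x<y →
    avoid (cycContains-at-start (refl ∷ ++⁺ˡ P (refl ∷ τ))
                                (ordIso-1234 <-numeral (All.lookup large (∈-++⁺ʳ P (to∈ τ))) x<y))

cycAvoids-1342⇒separated : ∀ {P Q} → All (2 <_) (P ++ Q) → Unique (P ++ Q) →
  CycAvoids (1 ∷ 3 ∷ 4 ∷ 2 ∷ []) (1 ∷ P ++ 2 ∷ Q) → Decreasing P → Decreasing Q → Separated P Q
cycAvoids-1342⇒separated {[]}              _     _        _     _  _  = inj₁ []
cycAvoids-1342⇒separated {_ ∷ _} {[]}      _     _        _     _  _  = inj₁ (All.tabulate (λ _ → []))
cycAvoids-1342⇒separated {p ∷ P} {q ∷ Q} large distinct avoid P↓ Q↓ with <-cmp p q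
... | tri≈ _ p≡q _ = ⊥-elim (AllPairs-pair distinct (refl ∷ ++⁺ˡ P (refl ∷ minimum Q)) p≡q)
... | tri< p<q _ _ = inj₂ (above-head P↓ (p<q ∷ All.tabulate p<Q))
  where
  p<Q : ∀ {y} → y ∈ Q → p < y
  p<Q {y} y∈Q = ≢∧≮⇒> (≢-sym (AllPairs-pair distinct (refl ∷ ++⁺ˡ P (q ∷ʳ from∈ y∈Q)))) λ y<p →
    avoid (cycContains-at-start (refl ∷ refl ∷ ++⁺ˡ P (2 ∷ʳ refl ∷ from∈ y∈Q)) (ordIso-1342 1<y y<p p<q))
    where
    1<y : 1 < y
    1<y = <-trans <-numeral (All.lookup large (∈-++⁺ʳ (p ∷ P) (there y∈Q)))
... | tri> _ _ q<p = inj₁ (above-head Q↓ (q<p ∷ All.tabulate q<P))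
  where
  q<P : ∀ {x} → x ∈ P → q < x
  q<P {x} x∈P = ≢∧≮⇒> (AllPairs-pair distinct (p ∷ʳ ++⁺ (from∈ x∈P) (refl ∷ minimum Q))) λ x<q →
    avoid (suc (length (p ∷ P)) , length-<-++ (1 ∷ p ∷ P) , _ ,
           subst (_ ⊆_) (sym (rotate-length-++ (1 ∷ p ∷ P) (2 ∷ q ∷ Q)))
                 (refl ∷ refl ∷ ++⁺ˡ Q (1 ∷ʳ refl ∷ from∈ x∈P)) ,
           ordIso-1342 (All.lookup large (there (∈-++⁺ˡ x∈P))) x<q q<p)

InAv⇒halves : ∀ {m σ} → InAv (2 + m) σ → ∃₂ λ P Q → σ ≡ 1 ∷ P ++ 2 ∷ Q × Halves (run 3 m) P Q
InAv⇒halves {m} {_ ∷ W} ((perm , refl) , avoid₁ , avoid₂) with ∈-resp-↭ (↭-sym perm) (there (here refl))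
... | there 2∈W with P , Q , refl ← ∈-∃++ 2∈W =
  P , Q , refl , separated⇒halves (run-decreasing 3 m) P↓ Q↓ sep (↭-trans P++Q↭ (↭-sym (run-↭ 3 m)))
  where
  P++Q↭ : P ++ Q ↭ applyUpTo (3 +_) m
  P++Q↭ = drop-∷ (drop-∷ (↭-trans (↭-sym (↭-prep 1 (shift 2 P Q))) perm))

  large : All (2 <_) (P ++ Q)
  large = All-resp-↭ (↭-sym P++Q↭) (All.applyUpTo⁺₂ (3 +_) m (m≤m+n 3))

  distinct : Unique (P ++ Q)
  distinct = Permutationₛ.Unique-resp-↭ (setoid ℕ) (↭⇒↭ₛ (↭-sym P++Q↭))
               (Unique.applyUpTo⁺₁ (3 +_) m (λ i<j _ → <⇒≢ (+-monoʳ-< 3 i<j)))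

  P↓ : Decreasing P
  P↓ = cycAvoids-1342⇒P-decreasing large distinct avoid₂

  Q↓ : Decreasing Q
  Q↓ = cycAvoids-1234⇒Q-decreasing large distinct avoid₁

  sep : Separated P Q
  sep = cycAvoids-1342⇒separated large distinct avoid₂ P↓ Q↓

halves⇒InAv : ∀ {m} P Q → Halves (run 3 m) P Q → InAv (2 + m) (1 ∷ P ++ 2 ∷ Q)
halves⇒InAv {m} P Q halves with runs , sep ← halves⇒twoRuns <-numeral (run-decreasing 3 m) (run-≥ 3 m) halves =
  (perm , refl) , twoRuns⇒cycAvoids-1234 runs , twoRuns⇒cycAvoids-1342 runs sep
  where
  perm : 1 ∷ P ++ 2 ∷ Q ↭ applyUpTo suc (2 + m)
  perm = ↭-prep 1 (↭-trans (shift 2 P Q) (↭-prep 2 (↭-trans (halves-↭ P Q halves) (run-↭ 3 m))))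

-- Descents and peaks

adjacent : (ℕ → ℕ → Bool) → List ℕ → List Bool
adjacent f (a ∷ b ∷ w) = f a b ∷ adjacent f (b ∷ w)
adjacent f _           = []

adjacent₃ : (ℕ → ℕ → ℕ → Bool) → List ℕ → List Bool
adjacent₃ f (a ∷ b ∷ c ∷ w) = f a b c ∷ adjacent₃ f (b ∷ c ∷ w)
adjacent₃ f _               = []

isDescent : ℕ → ℕ → Bool
isDescent a b = does (b <? a)

isPeak : ℕ → ℕ → ℕ → Bool
isPeak a b c = does (a <? b) ∧ does (c <? b)

des : List ℕ → ℕ
des w = count (adjacent isDescent w)

peaks : List ℕ → ℕ
peaks w = count (adjacent₃ isPeak w)

zipWith-∷ʳ : ∀ f a W b → zipWith f (a ∷ W) (W ++ [ b ]) ≡ adjacent f (a ∷ W ++ [ b ])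
zipWith-∷ʳ f a []      b = refl
zipWith-∷ʳ f a (w ∷ W) b = cong (f a w ∷_) (zipWith-∷ʳ f w W b)

zipWith3-∷ʳ : ∀ f a b V c d →
  zipWith3 f (a ∷ b ∷ V) (b ∷ V ++ [ c ]) (V ++ c ∷ d ∷ []) ≡ adjacent₃ f (a ∷ b ∷ V ++ c ∷ d ∷ [])
zipWith3-∷ʳ f a b []      c d = refl
zipWith3-∷ʳ f a b (v ∷ V) c d = cong (f a b v ∷_) (zipWith3-∷ʳ f b v V c d)

des-ascent : ∀ {a b} w → a < b → des (a ∷ b ∷ w) ≡ des (b ∷ w)
des-ascent {a} {b} w a<b rewrite dec-false (b <? a) (<-asym a<b) = refl

des-descent : ∀ {a b} w → b < a → des (a ∷ b ∷ w) ≡ suc (des (b ∷ w))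
des-descent {a} {b} w b<a rewrite dec-true (b <? a) b<a = refl

des-run : ∀ D {z} w → Decreasing (D ++ [ z ]) → des (D ++ z ∷ w) ≡ length D + des (z ∷ w)
des-run []          w _                 = refl
des-run (d ∷ [])    w ((z<d ∷ []) ∷ _)  = des-descent w z<d
des-run (d ∷ e ∷ D) w ((e<d ∷ _) ∷ D↓)  =
  trans (des-descent (D ++ _ ∷ w) e<d) (cong suc (des-run (e ∷ D) w D↓))

peaks-fall : ∀ {a b} w → b < a → peaks (a ∷ b ∷ w) ≡ peaks (b ∷ w)
peaks-fall         []      b<a = refl
peaks-fall {a} {b} (_ ∷ w) b<a rewrite dec-false (a <? b) (<-asym b<a) = refl

peaks-rise : ∀ {a b c} w → b < c → peaks (a ∷ b ∷ c ∷ w) ≡ peaks (b ∷ c ∷ w)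
peaks-rise {a} {b} {c} w b<c rewrite dec-false (c <? b) (<-asym b<c) | ∧-zeroʳ (does (a <? b)) = refl

peaks-peak : ∀ {a b c} w → a < b → c < b → peaks (a ∷ b ∷ c ∷ w) ≡ suc (peaks (b ∷ c ∷ w))
peaks-peak {a} {b} {c} w a<b c<b rewrite dec-true (a <? b) a<b | dec-true (c <? b) c<b = refl

peaks-run : ∀ D {z} w → Decreasing (D ++ [ z ]) → peaks (D ++ z ∷ w) ≡ peaks (z ∷ w)
peaks-run []          w _                = refl
peaks-run (d ∷ [])    w ((z<d ∷ []) ∷ _) = peaks-fall w z<d
peaks-run (d ∷ e ∷ D) w ((e<d ∷ _) ∷ D↓) = trans (peaks-fall (D ++ _ ∷ w) e<d) (peaks-run (e ∷ D) w D↓)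

peaks-mountain : ∀ {a e} E {z} w → a < e → Decreasing (e ∷ E ++ [ z ]) →
  peaks (a ∷ e ∷ E ++ z ∷ w) ≡ suc (peaks (z ∷ w))
peaks-mountain []      w a<e down@((z<e ∷ []) ∷ _) =
  trans (peaks-peak w a<e z<e) (cong suc (peaks-run (_ ∷ []) w down))
peaks-mountain (f ∷ E) w a<e down@((f<e ∷ _) ∷ _)  =
  trans (peaks-peak (E ++ _ ∷ w) a<e f<e) (cong suc (peaks-run (_ ∷ f ∷ E) w down))

cdes-∷ : ∀ x W → cdes (x ∷ W) ≡ des (x ∷ W ++ [ x ])
cdes-∷ x W = cong count (zipWith-∷ʳ isDescent x W x)

-- The first entry, being the minimum, is not a peak; so its neighbour on the left does not matter.
cpk-∷ : ∀ x W → All (x <_) W → cpk (x ∷ W) ≡ peaks (x ∷ W ++ [ x ])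
cpk-∷ x W x<W with initLast W
... | [] rewrite dec-false (x <? x) (<-irrefl refl) = refl
... | W′ ∷ʳ′ ℓ = begin
  cpk (x ∷ W′ ++ [ ℓ ])
    ≡⟨ cong (λ σ → count (zipWith3 isPeak σ (x ∷ W′ ++ [ ℓ ]) ((W′ ++ [ ℓ ]) ++ [ x ]))) rotate-last ⟩
  count (zipWith3 isPeak (ℓ ∷ x ∷ W′) (x ∷ W′ ++ [ ℓ ]) ((W′ ++ [ ℓ ]) ++ [ x ]))
    ≡⟨ cong (count ∘ zipWith3 isPeak (ℓ ∷ x ∷ W′) (x ∷ W′ ++ [ ℓ ])) (++-assoc W′ [ ℓ ] [ x ]) ⟩
  count (zipWith3 isPeak (ℓ ∷ x ∷ W′) (x ∷ W′ ++ [ ℓ ]) (W′ ++ ℓ ∷ x ∷ []))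
    ≡⟨ cong count (zipWith3-∷ʳ isPeak ℓ x W′ ℓ x) ⟩
  peaks (ℓ ∷ x ∷ W′ ++ ℓ ∷ x ∷ [])
    ≡⟨ peaks-fall (W′ ++ ℓ ∷ x ∷ []) (All.head (All.++⁻ʳ W′ x<W)) ⟩
  peaks (x ∷ W′ ++ ℓ ∷ x ∷ [])
    ≡⟨ cong (λ w → peaks (x ∷ w)) (sym (++-assoc W′ [ ℓ ] [ x ])) ⟩
  peaks (x ∷ (W′ ++ [ ℓ ]) ++ [ x ]) ∎
  where
  open ≡-Reasoning
  rotate-last : rotate (length (W′ ++ [ ℓ ])) ((x ∷ W′) ++ [ ℓ ]) ≡ ℓ ∷ x ∷ W′
  rotate-last = trans (cong (λ k → rotate k ((x ∷ W′) ++ [ ℓ ])) (trans (length-++ W′) (+-comm (length W′) 1)))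
                      (rotate-length-++ (x ∷ W′) [ ℓ ])

module _ {x y : ℕ} (x<y : x < y) where

  private
    des-climb : ∀ P R → All (x <_) P → Decreasing (P ++ [ y ]) →
      des (x ∷ P ++ y ∷ R) ≡ length P + des (y ∷ R)
    des-climb []      R _         _    = des-ascent R x<y
    des-climb (p ∷ P) R (x<p ∷ _) down = trans (des-ascent (P ++ y ∷ R) x<p) (des-run (p ∷ P) R down)

    x<P++y∷Q : ∀ {P Q} → TwoRuns x y P Q → All (x <_) (P ++ y ∷ Q)
    x<P++y∷Q runs = All.++⁺ (TwoRuns.x<P runs) (x<y ∷ All.map (<-trans x<y) (TwoRuns.y<Q runs))

  cdes-twoRuns : ∀ P Q → TwoRuns x y P Q → cdes (x ∷ P ++ y ∷ Q) ≡ length P + des (y ∷ Q ++ [ x ])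
  cdes-twoRuns P Q runs = begin
    cdes (x ∷ P ++ y ∷ Q)            ≡⟨ cdes-∷ x (P ++ y ∷ Q) ⟩
    des (x ∷ (P ++ y ∷ Q) ++ [ x ])  ≡⟨ cong (λ w → des (x ∷ w)) (++-assoc P (y ∷ Q) [ x ]) ⟩
    des (x ∷ P ++ y ∷ Q ++ [ x ])    ≡⟨ des-climb P (Q ++ [ x ]) (TwoRuns.x<P runs) (TwoRuns.run₁ runs) ⟩
    length P + des (y ∷ Q ++ [ x ])  ∎
    where open ≡-Reasoning

  cdes-twoRuns-[] : ∀ P → TwoRuns x y P [] → cdes (x ∷ P ++ y ∷ []) ≡ length P + 1
  cdes-twoRuns-[] P runs = trans (cdes-twoRuns P [] runs) (cong (length P +_) (des-descent [] x<y))

  cdes-twoRuns-∷ : ∀ P q Q → TwoRuns x y P (q ∷ Q) →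
    cdes (x ∷ P ++ y ∷ q ∷ Q) ≡ length P + length (q ∷ Q)
  cdes-twoRuns-∷ P q Q runs = trans (cdes-twoRuns P (q ∷ Q) runs) (cong (length P +_) (begin
    des (y ∷ q ∷ Q ++ [ x ])  ≡⟨ des-ascent (Q ++ [ x ]) (All.head (TwoRuns.y<Q runs)) ⟩
    des (q ∷ Q ++ x ∷ [])     ≡⟨ des-run (q ∷ Q) [] (TwoRuns.run₂ runs) ⟩
    length (q ∷ Q) + 0        ≡⟨ +-identityʳ _ ⟩
    length (q ∷ Q)            ∎))
    where open ≡-Reasoning

  cpk-twoRuns : ∀ P Q → TwoRuns x y P Q → cpk (x ∷ P ++ y ∷ Q) ≡ peaks (x ∷ P ++ y ∷ Q ++ [ x ])
  cpk-twoRuns P Q runs =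
    trans (cpk-∷ x (P ++ y ∷ Q) (x<P++y∷Q runs)) (cong (λ w → peaks (x ∷ w)) (++-assoc P (y ∷ Q) [ x ]))

  cpk-twoRuns-∷-∷ : ∀ p P q Q → TwoRuns x y (p ∷ P) (q ∷ Q) → cpk (x ∷ (p ∷ P) ++ y ∷ q ∷ Q) ≡ 2
  cpk-twoRuns-∷-∷ p P q Q runs = begin
    cpk (x ∷ (p ∷ P) ++ y ∷ q ∷ Q)          ≡⟨ cpk-twoRuns (p ∷ P) (q ∷ Q) runs ⟩
    peaks (x ∷ p ∷ P ++ y ∷ q ∷ Q ++ [ x ]) ≡⟨ peaks-mountain P _ (All.head x<P) run₁ ⟩
    suc (peaks (y ∷ q ∷ Q ++ x ∷ []))       ≡⟨ cong suc (peaks-mountain Q [] (All.head y<Q) run₂) ⟩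
    2                                       ∎
    where
    open ≡-Reasoning
    open TwoRuns runs

  cpk-twoRuns-∷-[] : ∀ p P → TwoRuns x y (p ∷ P) [] → cpk (x ∷ (p ∷ P) ++ y ∷ []) ≡ 1
  cpk-twoRuns-∷-[] p P runs =
    trans (cpk-twoRuns (p ∷ P) [] runs) (peaks-mountain P _ (All.head (TwoRuns.x<P runs)) (TwoRuns.run₁ runs))

  cpk-twoRuns-[]-∷ : ∀ q Q → TwoRuns x y [] (q ∷ Q) → cpk (x ∷ y ∷ q ∷ Q) ≡ 1
  cpk-twoRuns-[]-∷ q Q runs = begin
    cpk (x ∷ y ∷ q ∷ Q)             ≡⟨ cpk-twoRuns [] (q ∷ Q) runs ⟩
    peaks (x ∷ y ∷ q ∷ Q ++ [ x ])  ≡⟨ peaks-rise (Q ++ [ x ]) (All.head y<Q) ⟩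
    peaks (y ∷ q ∷ Q ++ x ∷ [])     ≡⟨ peaks-mountain Q [] (All.head y<Q) run₂ ⟩
    1                               ∎
    where
    open ≡-Reasoning
    open TwoRuns runs

-- Enumeration

cuts : ℕ → List (ℕ × ℕ)
cuts zero    = []
cuts (suc k) = (0 , k) ∷ map (Product.map₁ suc) (cuts k)

∈-cuts⁻ : ∀ k {p q} → (p , q) ∈ cuts k → suc (p + q) ≡ k
∈-cuts⁻ (suc k) (here refl) = refl
∈-cuts⁻ (suc k) (there pq∈) with _ , pq∈′ , refl ← ∈-map⁻ (Product.map₁ suc) pq∈ =
  cong suc (∈-cuts⁻ k pq∈′)

∈-cuts⁺ : ∀ k {p q} → suc (p + q) ≡ k → (p , q) ∈ cuts k
∈-cuts⁺ (suc k) {zero}  refl = here refl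
∈-cuts⁺ (suc k) {suc p} refl = there (∈-map⁺ (Product.map₁ suc) (∈-cuts⁺ k refl))

length-cuts : ∀ k → length (cuts k) ≡ k
length-cuts zero    = refl
length-cuts (suc k) = cong suc (trans (length-map (Product.map₁ suc) (cuts k)) (length-cuts k))

cuts-unique : ∀ k → Unique (cuts k)
cuts-unique zero    = []
cuts-unique (suc k) = All.tabulate 0≢ ∷ Unique.map⁺ map₁-suc-injective (cuts-unique k)
  where
  0≢ : ∀ {pq} → pq ∈ map (Product.map₁ suc) (cuts k) → (0 , k) ≢ pq
  0≢ pq∈ refl with _ , _ , () ← ∈-map⁻ (Product.map₁ suc) pq∈
  map₁-suc-injective : ∀ {pq pq′ : ℕ × ℕ} → Product.map₁ suc pq ≡ Product.map₁ suc pq′ → pq ≡ pq′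
  map₁-suc-injective refl = refl

-- For n = 3 + k the halves of run 3 (suc k) = [n, …, 3] are: P empty, Q empty, or both nonempty
-- with P the lower or the upper part.
data Shape : Set where
  twoSecond twoLast : Shape
  lowHigh highLow   : ℕ → ℕ → Shape

blocks : ℕ → Shape → List ℕ × List ℕ
blocks k twoSecond     = [] , run 3 (suc k)
blocks k twoLast       = run 3 (suc k) , []
blocks k (lowHigh p q) = run 3 (suc p) , run (4 + p) (suc q)
blocks k (highLow p q) = run (4 + q) (suc p) , run 3 (suc q)

avoider : ℕ → Shape → List ℕ
avoider k s = 1 ∷ proj₁ (blocks k s) ++ 2 ∷ proj₂ (blocks k s)

innerShapes : ℕ → List Shape
innerShapes k = map (Product.uncurry lowHigh) (cuts k) ++ map (Product.uncurry highLow) (cuts k)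

shapes : ℕ → List Shape
shapes k = twoSecond ∷ innerShapes k ++ twoLast ∷ []

data InnerShape (k : ℕ) : Shape → Set where
  lowHigh : ∀ {p q} → suc (p + q) ≡ k → InnerShape k (lowHigh p q)
  highLow : ∀ {p q} → suc (p + q) ≡ k → InnerShape k (highLow p q)

data ValidShape (k : ℕ) : Shape → Set where
  twoSecond : ValidShape k twoSecond
  twoLast   : ValidShape k twoLast
  inner     : ∀ {s} → InnerShape k s → ValidShape k s

∈-innerShapes⁻ : ∀ k {s} → s ∈ innerShapes k → InnerShape k s
∈-innerShapes⁻ k s∈ with ∈-++⁻ (map (Product.uncurry lowHigh) (cuts k)) s∈
... | inj₁ s∈lh with _ , pq∈ , refl ← ∈-map⁻ (Product.uncurry lowHigh) s∈lh = lowHigh (∈-cuts⁻ k pq∈)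
... | inj₂ s∈hl with _ , pq∈ , refl ← ∈-map⁻ (Product.uncurry highLow) s∈hl = highLow (∈-cuts⁻ k pq∈)

∈-shapes⁻ : ∀ k {s} → s ∈ shapes k → ValidShape k s
∈-shapes⁻ k (here refl) = twoSecond
∈-shapes⁻ k (there s∈) with ∈-++⁻ (innerShapes k) s∈
... | inj₁ s∈inner     = inner (∈-innerShapes⁻ k s∈inner)
... | inj₂ (here refl) = twoLast

∈-shapes⁺ : ∀ k {s} → ValidShape k s → s ∈ shapes k
∈-shapes⁺ k twoSecond           = here refl
∈-shapes⁺ k twoLast             = there (∈-++⁺ʳ (innerShapes k) (here refl))
∈-shapes⁺ k (inner (lowHigh e)) =
  there (∈-++⁺ˡ (∈-++⁺ˡ (∈-map⁺ (Product.uncurry lowHigh) (∈-cuts⁺ k e))))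
∈-shapes⁺ k (inner (highLow e)) =
  there (∈-++⁺ˡ (∈-++⁺ʳ (map (Product.uncurry lowHigh) (cuts k))
                        (∈-map⁺ (Product.uncurry highLow) (∈-cuts⁺ k e))))

innerShapes-unique : ∀ k → Unique (innerShapes k)
innerShapes-unique k =
  Unique.++⁺ (Unique.map⁺ lowHigh-injective (cuts-unique k)) (Unique.map⁺ highLow-injective (cuts-unique k))
             disjoint
  where
  lowHigh-injective : ∀ {pq pq′} → Product.uncurry lowHigh pq ≡ Product.uncurry lowHigh pq′ → pq ≡ pq′
  lowHigh-injective refl = refl
  highLow-injective : ∀ {pq pq′} → Product.uncurry highLow pq ≡ Product.uncurry highLow pq′ → pq ≡ pq′
  highLow-injective refl = refl
  disjoint : ∀ {s} → s ∈ map (Product.uncurry lowHigh) (cuts k) × s ∈ map (Product.uncurry highLow) (cuts k) →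
    ⊥
  disjoint (s∈lh , s∈hl) with _ , _ , refl ← ∈-map⁻ (Product.uncurry lowHigh) s∈lh
                         with _ , _ , () ← ∈-map⁻ (Product.uncurry highLow) s∈hl

shapes-unique : ∀ k → Unique (shapes k)
shapes-unique k = All.tabulate twoSecond∉ ∷ Unique.++⁺ (innerShapes-unique k) ([] ∷ []) twoLast∉
  where
  twoSecond∉ : ∀ {s} → s ∈ innerShapes k ++ twoLast ∷ [] → twoSecond ≢ s
  twoSecond∉ s∈ refl with ∈-++⁻ (innerShapes k) s∈
  ... | inj₁ s∈inner with () ← ∈-innerShapes⁻ k s∈inner
  ... | inj₂ (here ())
  twoLast∉ : ∀ {s} → s ∈ innerShapes k × s ∈ twoLast ∷ [] → ⊥
  twoLast∉ (s∈ , here refl) with () ← ∈-innerShapes⁻ k s∈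

2∉blocks : ∀ k s → 2 ∉ proj₁ (blocks k s)
2∉blocks k twoSecond     ()
2∉blocks k twoLast       2∈ = <-irrefl refl (All.lookup (run-≥ 3 (suc k)) 2∈)
2∉blocks k (lowHigh p q) 2∈ = <-irrefl refl (All.lookup (run-≥ 3 (suc p)) 2∈)
2∉blocks k (highLow p q) 2∈ =
  <-irrefl refl (≤-trans (s≤s (s≤s (s≤s z≤n))) (All.lookup (run-≥ (4 + q) (suc p)) 2∈))

lower≢upper : ∀ {p q p′} → run 3 (suc p) ≢ run (4 + q) (suc p′)
lower≢upper eq with head≡ , tail≡ ← ∷-injective eq rewrite run-injectiveʳ tail≡ =
  m≢1+n+m _ (suc-injective (suc-injective (suc-injective head≡)))

blocks-injective : ∀ k {s s′} → blocks k s ≡ blocks k s′ → s ≡ s′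
blocks-injective k {twoSecond}   {twoSecond}     _  = refl
blocks-injective k {twoLast}     {twoLast}       _  = refl
blocks-injective k {lowHigh p q} {lowHigh p′ q′} eq =
  cong₂ lowHigh (suc-injective (run-injectiveʳ (cong proj₁ eq))) (suc-injective (run-injectiveʳ (cong proj₂ eq)))
blocks-injective k {highLow p q} {highLow p′ q′} eq =
  cong₂ highLow (suc-injective (run-injectiveʳ (cong proj₁ eq))) (suc-injective (run-injectiveʳ (cong proj₂ eq)))
blocks-injective k {lowHigh p q} {highLow p′ q′} eq = ⊥-elim (lower≢upper (cong proj₁ eq))
blocks-injective k {highLow p q} {lowHigh p′ q′} eq = ⊥-elim (lower≢upper (sym (cong proj₁ eq)))
blocks-injective k {twoSecond}   {twoLast}       ()
blocks-injective k {twoSecond}   {lowHigh _ _}   ()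
blocks-injective k {twoSecond}   {highLow _ _}   ()
blocks-injective k {twoLast}     {twoSecond}     ()
blocks-injective k {twoLast}     {lowHigh _ _}   ()
blocks-injective k {twoLast}     {highLow _ _}   ()
blocks-injective k {lowHigh _ _} {twoSecond}     ()
blocks-injective k {lowHigh _ _} {twoLast}       ()
blocks-injective k {highLow _ _} {twoSecond}     ()
blocks-injective k {highLow _ _} {twoLast}       ()

avoider-injective : ∀ k {s s′} → avoider k s ≡ avoider k s′ → s ≡ s′
avoider-injective k {s} {s′} eq =
  blocks-injective k (split-at (proj₁ (blocks k s)) (2∉blocks k s) (2∉blocks k s′) (proj₂ (∷-injective eq)))

cut-sum : ∀ {p q k} → suc (p + q) ≡ k → suc p + suc q ≡ suc k
cut-sum {p} {q} e = cong suc (trans (+-suc p q) e)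

cut-sum⁻ : ∀ {p q k} → suc p + suc q ≡ suc k → suc (p + q) ≡ k
cut-sum⁻ {p} {q} e = trans (sym (+-suc p q)) (suc-injective e)

shape-halves : ∀ k {s} → ValidShape k s → Halves (run 3 (suc k)) (proj₁ (blocks k s)) (proj₂ (blocks k s))
shape-halves k twoSecond = inj₁ refl
shape-halves k twoLast   = inj₁ (++-identityʳ _)
shape-halves k (inner (lowHigh {p} {q} e)) =
  inj₂ (trans (sym (run-++ 3 (suc q) (suc p))) (cong (run 3) (cut-sum (trans (cong suc (+-comm q p)) e))))
shape-halves k (inner (highLow {p} {q} e)) =
  inj₁ (trans (sym (run-++ 3 (suc p) (suc q))) (cong (run 3) (cut-sum e)))

halves⇒shape : ∀ k P Q → Halves (run 3 (suc k)) P Q → ∃ λ s → ValidShape k s × blocks k s ≡ (P , Q)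
halves⇒shape k []      Q       (inj₁ refl) = twoSecond , twoSecond , refl
halves⇒shape k []      Q       (inj₂ eq)   =
  twoSecond , twoSecond , cong ([] ,_) (trans (sym eq) (++-identityʳ Q))
halves⇒shape k (p ∷ P) []      (inj₁ eq)   =
  twoLast , twoLast , cong (_, []) (trans (sym eq) (++-identityʳ (p ∷ P)))
halves⇒shape k (p ∷ P) []      (inj₂ refl) = twoLast , twoLast , refl
halves⇒shape k (p ∷ P) (q ∷ Q) (inj₁ eq) with (P≡ , Q≡) , lengths ← split-run (p ∷ P) (q ∷ Q) eq =
  highLow (length P) (length Q) , inner (highLow (cut-sum⁻ lengths)) , cong₂ _,_ (sym P≡) (sym Q≡)
halves⇒shape k (p ∷ P) (q ∷ Q) (inj₂ eq) with (Q≡ , P≡) , lengths ← split-run (q ∷ Q) (p ∷ P) eq =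
  lowHigh (length P) (length Q) , inner (lowHigh (trans (cong suc (+-comm (length P) (length Q))) (cut-sum⁻ lengths))) ,
  cong₂ _,_ (sym P≡) (sym Q≡)

shape-twoRuns : ∀ k {s} → ValidShape k s → TwoRuns 1 2 (proj₁ (blocks k s)) (proj₂ (blocks k s))
shape-twoRuns k valid =
  proj₁ (halves⇒twoRuns <-numeral (run-decreasing 3 (suc k)) (run-≥ 3 (suc k)) (shape-halves k valid))

monomial : List ℕ → ℕ × ℕ × ℕ
monomial σ = 1 , cdes σ , cpk σ

monomial-twoSecond : ∀ k → monomial (avoider k twoSecond) ≡ (1 , suc k , 1)
monomial-twoSecond k = cong₂ (λ e f → 1 , e , f)
  (trans (cdes-twoRuns-∷ <-numeral [] _ (run 3 k) runs) (cong suc (length-run 3 k)))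
  (cpk-twoRuns-[]-∷ <-numeral _ (run 3 k) runs)
  where
  runs : TwoRuns 1 2 [] (run 3 (suc k))
  runs = shape-twoRuns k twoSecond

monomial-twoLast : ∀ k → monomial (avoider k twoLast) ≡ (1 , suc (suc k) , 1)
monomial-twoLast k = cong₂ (λ e f → 1 , e , f)
  (trans (cdes-twoRuns-[] <-numeral (run 3 (suc k)) runs) (trans (cong (_+ 1) (length-run 3 (suc k))) (+-comm (suc k) 1)))
  (cpk-twoRuns-∷-[] <-numeral _ (run 3 k) runs)
  where
  runs : TwoRuns 1 2 (run 3 (suc k)) []
  runs = shape-twoRuns k twoLast

monomial-inner : ∀ k {s} → InnerShape k s → monomial (avoider k s) ≡ (1 , suc k , 2)
monomial-inner k (lowHigh {p} {q} e) = cong₂ (λ e f → 1 , e , f)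
  (trans (cdes-twoRuns-∷ <-numeral (run 3 (suc p)) _ (run (4 + p) q) runs)
         (trans (cong₂ _+_ (length-run 3 (suc p)) (length-run (4 + p) (suc q))) (cut-sum e)))
  (cpk-twoRuns-∷-∷ <-numeral _ (run 3 p) _ (run (4 + p) q) runs)
  where
  runs : TwoRuns 1 2 (run 3 (suc p)) (run (4 + p) (suc q))
  runs = shape-twoRuns k (inner (lowHigh e))
monomial-inner k (highLow {p} {q} e) = cong₂ (λ e f → 1 , e , f)
  (trans (cdes-twoRuns-∷ <-numeral (run (4 + q) (suc p)) _ (run 3 q) runs)
         (trans (cong₂ _+_ (length-run (4 + q) (suc p)) (length-run 3 (suc q))) (cut-sum e)))
  (cpk-twoRuns-∷-∷ <-numeral _ (run (4 + q) p) _ (run 3 q) runs)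
  where
  runs : TwoRuns 1 2 (run (4 + q) (suc p)) (run 3 (suc q))
  runs = shape-twoRuns k (inner (highLow e))

coeff-∷ : ∀ m ms ms′ d t → coeff ms d t ≡ coeff ms′ d t → coeff (m ∷ ms) d t ≡ coeff (m ∷ ms′) d t
coeff-∷ (c , e , f) ms ms′ d t = cong ((if does (e ≟ d) ∧ does (f ≟ t) then c else 0) +_)

coeff-constant : ∀ {e f} ms rest d t → All (_≡ (1 , e , f)) ms →
  coeff (ms ++ rest) d t ≡ coeff ((length ms , e , f) ∷ rest) d t
coeff-constant {e} {f} [] rest d t [] with does (e ≟ d) ∧ does (f ≟ t)
... | true  = refl
... | false = refl
coeff-constant {e} {f} (_ ∷ ms) rest d t (refl ∷ ms≡) rewrite coeff-constant ms rest d t ms≡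
  with does (e ≟ d) ∧ does (f ≟ t)
... | true  = refl
... | false = refl

genPoly-avoiders : ∀ k → genPoly (map (avoider k) (shapes k)) ≡
  (1 , suc k , 1) ∷ map (monomial ∘ avoider k) (innerShapes k) ++ (1 , suc (suc k) , 1) ∷ []
genPoly-avoiders k = cong₂ _∷_ (monomial-twoSecond k) (begin
  map monomial (map (avoider k) (innerShapes k ++ twoLast ∷ []))
    ≡⟨ sym (map-∘ (innerShapes k ++ twoLast ∷ [])) ⟩
  map (monomial ∘ avoider k) (innerShapes k ++ twoLast ∷ [])
    ≡⟨ map-++ (monomial ∘ avoider k) (innerShapes k) _ ⟩
  map (monomial ∘ avoider k) (innerShapes k) ++ monomial (avoider k twoLast) ∷ []
    ≡⟨ cong (λ m → map (monomial ∘ avoider k) (innerShapes k) ++ m ∷ []) (monomial-twoLast k) ⟩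
  map (monomial ∘ avoider k) (innerShapes k) ++ (1 , suc (suc k) , 1) ∷ [] ∎)
  where open ≡-Reasoning

length-innerShapes : ∀ k → length (map (monomial ∘ avoider k) (innerShapes k)) ≡ 2 * (3 + k) ∸ 6
length-innerShapes k = begin
  length (map (monomial ∘ avoider k) (innerShapes k))  ≡⟨ length-map _ (innerShapes k) ⟩
  length (innerShapes k)                               ≡⟨ length-++ (map (Product.uncurry lowHigh) (cuts k)) ⟩
  length (map _ (cuts k)) + length (map _ (cuts k))    ≡⟨ cong₂ _+_ (length-map _ (cuts k)) (length-map _ (cuts k)) ⟩
  length (cuts k) + length (cuts k)                    ≡⟨ cong₂ _+_ (length-cuts k) (length-cuts k) ⟩
  k + k                                                ≡⟨ cong (k +_) (sym (+-identityʳ k)) ⟩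
  2 * k                                                ≡⟨ sym (m+n∸m≡n 6 (2 * k)) ⟩
  6 + 2 * k ∸ 6                                        ≡⟨ cong (_∸ 6) (sym (*-distribˡ-+ 2 3 k)) ⟩
  2 * (3 + k) ∸ 6                                      ∎
  where open ≡-Reasoning

coeff-avoiders : ∀ k d t → coeff (genPoly (map (avoider k) (shapes k))) d t ≡ coeff (rhsPoly (3 + k)) d t
coeff-avoiders k d t = begin
  coeff (genPoly (map (avoider k) (shapes k))) d t
    ≡⟨ cong (λ ms → coeff ms d t) (genPoly-avoiders k) ⟩
  coeff ((1 , suc k , 1) ∷ innerMonomials ++ last) d t
    ≡⟨ coeff-∷ (1 , suc k , 1) (innerMonomials ++ last) ((length innerMonomials , suc k , 2) ∷ last) d t
               (coeff-constant innerMonomials last d t innerMonomials-constant) ⟩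
  coeff ((1 , suc k , 1) ∷ (length innerMonomials , suc k , 2) ∷ last) d t
    ≡⟨ cong (λ c → coeff ((1 , suc k , 1) ∷ (c , suc k , 2) ∷ last) d t) (length-innerShapes k) ⟩
  coeff (rhsPoly (3 + k)) d t ∎
  where
  open ≡-Reasoning
  last : List (ℕ × ℕ × ℕ)
  last = (1 , suc (suc k) , 1) ∷ []
  innerMonomials : List (ℕ × ℕ × ℕ)
  innerMonomials = map (monomial ∘ avoider k) (innerShapes k)
  innerMonomials-constant : All (_≡ (1 , suc k , 2)) innerMonomials
  innerMonomials-constant = All.map⁺ (All.tabulate (λ s∈ → monomial-inner k (∈-innerShapes⁻ k s∈)))

∈-avoiders⇔InAv : ∀ k σ → σ ∈ map (avoider k) (shapes k) ⇔ InAv (3 + k) σ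
∈-avoiders⇔InAv k σ = mk⇔ ∈⇒InAv InAv⇒∈
  where
  ∈⇒InAv : ∀ {σ} → σ ∈ map (avoider k) (shapes k) → InAv (3 + k) σ
  ∈⇒InAv σ∈ with s , s∈ , refl ← ∈-map⁻ (avoider k) {xs = shapes k} σ∈ =
    halves⇒InAv (proj₁ (blocks k s)) (proj₂ (blocks k s)) (shape-halves k (∈-shapes⁻ k s∈))
  InAv⇒∈ : ∀ {σ} → InAv (3 + k) σ → σ ∈ map (avoider k) (shapes k)
  InAv⇒∈ inAv
    with P , Q , refl , halves ← InAv⇒halves inAv
    with s , valid , blocks≡ ← halves⇒shape k P Q halves =
    subst (_∈ map (avoider k) (shapes k)) (cong (λ PQ → 1 ∷ proj₁ PQ ++ 2 ∷ proj₂ PQ) blocks≡)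
          (∈-map⁺ (avoider k) (∈-shapes⁺ k valid))

mainTheorem20 : (n : ℕ) → 3 ≤ n →
    Σ[ L ∈ List (List ℕ) ]
      (Unique L × (∀ σ → (σ ∈ L ⇔ InAv n σ))
        × (∀ d p → coeff (genPoly L) d p ≡ coeff (rhsPoly n) d p))
mainTheorem20 (suc (suc (suc k))) (s≤s (s≤s (s≤s _))) =
  map (avoider k) (shapes k) ,
  Unique.map⁺ (avoider-injective k) (shapes-unique k) ,
  ∈-avoiders⇔InAv k ,
  coeff-avoiders k
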